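{- Let $e$ be a quadratic word equation of notational length $N$ and let $L = \mathrm{reduce}(e)$. Then for each pair $(e', \sigma) \in L$, where $e'$ has notational length $N'$: (P1) $e'$ is unsatisfiable or a quadratic word equation; and (P2) $N' \le N$.
   Context: Let $\Sigma$ be a finite alphabet. String terms are finite concatenations of letters and string variables; a word equation is $s_1 = s_2$ with $s_1,s_2$ string terms; it is quadratic if each variable occurs at most twice in it; its notational length is its number of symbol occurrences. For a substitution $\sigma=[t/x]$, $e\sigma$ replaces every occurrence of $x$ in $e$ by $t$. $\mathrm{match}(e)$: if $e \equiv u t_1 = u t_2$ with the same letter or variable $u$ at both heads, $\mathrm{match}(e) \equiv t_1 = t_2$, otherwise $\mathrm{match}(e)\equiv e$. $\mathrm{complete}(e)$, for an equation whose sides have different heads at least one of which is a variable: if $e \equiv x_1t_1 = c_2t_2$ (or symmetrically) with $x_1$ a variable and $c_2$ a letter, it is $\{(e[\epsilon/x_1],[\epsilon/x_1]), (e[c_2x_1'/x_1],[c_2x_1'/x_1])\}$; if $e \equiv x_1t_1 = x_2t_2$ with distinct variables, it is $\{(e\sigma,\sigma) : \sigma \in \{[\epsilon/x_1],[x_2x_1'/x_1],[\epsilon/x_2],[x_1x_2'/x_2]\}\}$, with $x_1',x_2'$ fresh variables. Finally $\mathrm{reduce}(e) = \{(\mathrm{match}(e''),\sigma) : (e'',\sigma) \in \mathrm{complete}(e)\}$. -}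

module Defs where

open import Data.Nat using (ℕ; zero; suc; _+_; _≡ᵇ_)
import Data.Nat.Properties as ℕP
open import Data.Fin using (Fin)
import Data.Fin.Properties as FinP
open import Data.List using (List; []; _∷_; _++_; [_]; concatMap; length)
open import Data.Product using (_×_; _,_; ∃)
open import Data.Bool using (if_then_else_)
open import Relation.Binary.PropositionalEquality using (_≡_; refl; cong)
open import Relation.Nullary using (Dec; yes; no; ¬_)

data Sym (k : ℕ) : Set where
  lit : Fin k → Sym k
  var : ℕ → Sym k

Term : ℕ → Set
Term k = List (Sym k)

infix 4 _≐_
record Eqn (k : ℕ) : Set where
  constructor _≐_
  field
    lhs : Term k
    rhs : Term k
open Eqn public

_≟ˢ_ : ∀ {k} (u v : Sym k) → Dec (u ≡ v)
lit a ≟ˢ lit b with a FinP.≟ b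
... | yes refl = yes refl
... | no a≢b = no λ { refl → a≢b refl }
lit a ≟ˢ var y = no λ ()
var x ≟ˢ lit b = no λ ()
var x ≟ˢ var y with x ℕP.≟ y
... | yes refl = yes refl
... | no x≢y = no λ { refl → x≢y refl }

-- A substitution [t/x] is represented as the pair (x , t).
Subst : ℕ → Set
Subst k = ℕ × Term k

substSym : ∀ {k} → Subst k → Sym k → Term k
substSym σ (lit a) = [ lit a ]
substSym (x , t) (var y) = if y ≡ᵇ x then t else [ var y ]

substT : ∀ {k} → Subst k → Term k → Term k
substT σ s = concatMap (substSym σ) s

substE : ∀ {k} → Eqn k → Subst k → Eqn k
substE (s₁ ≐ s₂) σ = substT σ s₁ ≐ substT σ s₂

match : ∀ {k} → Eqn k → Eqn k
match (u ∷ t₁ ≐ v ∷ t₂) with u ≟ˢ v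
... | yes _ = t₁ ≐ t₂
... | no _ = u ∷ t₁ ≐ v ∷ t₂
match e = e

-- complete(e), with the fresh variables x₁' and x₂' supplied as arguments.
-- complete is only defined for equations whose sides have different heads,
-- at least one a variable; on all other equations we return [] (so the
-- theorem says nothing about them).
complete : ∀ {k} → Eqn k → (x₁' x₂' : ℕ) → List (Eqn k × Subst k)
complete e@(var x₁ ∷ t₁ ≐ lit c₂ ∷ t₂) x₁' x₂' =
  (substE e (x₁ , []) , (x₁ , [])) ∷
  (substE e (x₁ , lit c₂ ∷ var x₁' ∷ []) , (x₁ , lit c₂ ∷ var x₁' ∷ [])) ∷ []
complete e@(lit c₁ ∷ t₁ ≐ var x₂ ∷ t₂) x₁' x₂' =
  (substE e (x₂ , []) , (x₂ , [])) ∷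
  (substE e (x₂ , lit c₁ ∷ var x₂' ∷ []) , (x₂ , lit c₁ ∷ var x₂' ∷ [])) ∷ []
complete e@(var x₁ ∷ t₁ ≐ var x₂ ∷ t₂) x₁' x₂' with x₁ ℕP.≟ x₂
... | yes _ = []
... | no _ =
  (substE e (x₁ , []) , (x₁ , [])) ∷
  (substE e (x₁ , var x₂ ∷ var x₁' ∷ []) , (x₁ , var x₂ ∷ var x₁' ∷ [])) ∷
  (substE e (x₂ , []) , (x₂ , [])) ∷
  (substE e (x₂ , var x₁ ∷ var x₂' ∷ []) , (x₂ , var x₁ ∷ var x₂' ∷ [])) ∷ []
complete e x₁' x₂' = []

reduce : ∀ {k} → Eqn k → (x₁' x₂' : ℕ) → List (Eqn k × Subst k)
reduce e x₁' x₂' = go (complete e x₁' x₂')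
  where
  go : List (Eqn _ × Subst _) → List (Eqn _ × Subst _)
  go [] = []
  go ((e'' , σ) ∷ rest) = (match e'' , σ) ∷ go rest

occT : ∀ {k} → ℕ → Term k → ℕ
occT x [] = 0
occT x (lit _ ∷ s) = occT x s
occT x (var y ∷ s) = (if y ≡ᵇ x then 1 else 0) + occT x s

occ : ∀ {k} → ℕ → Eqn k → ℕ
occ x (s₁ ≐ s₂) = occT x s₁ + occT x s₂

Quadratic : ∀ {k} → Eqn k → Set
Quadratic e = ∀ x → occ x e Data.Nat.≤ 2

len : ∀ {k} → Eqn k → ℕ
len (s₁ ≐ s₂) = length s₁ + length s₂

evalT : ∀ {k} → (ℕ → List (Fin k)) → Term k → List (Fin k)
evalT h [] = []
evalT h (lit a ∷ s) = a ∷ evalT h s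
evalT h (var x ∷ s) = h x ++ evalT h s

Satisfiable : ∀ {k} → Eqn k → Set
Satisfiable {k} (s₁ ≐ s₂) = ∃ λ (h : ℕ → List (Fin k)) → evalT h s₁ ≡ evalT h s₂

Unsatisfiable : ∀ {k} → Eqn k → Set
Unsatisfiable e = ¬ Satisfiable e

{-# OPTIONS --safe #-}
-- Erasing a variable creates neither occurrences nor symbols, and match only deletes.
-- In the splitting branch x := h x' of var x ∷ t₁ ≐ h ∷ t₂, matching the common head h
-- leaves exactly x := h x' applied to e₀ = var x' ∷ t₁ ≐ t₂.  As x heads a side of the
-- quadratic equation, it occurs at most once in e₀, so the substitution adds at most one
-- symbol (and len e₀ + 1 = len e) and at most the occurrences of h x' to each variable;
-- e₀ together with h x' still has every variable at most twice (the fresh x' exactly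
-- twice).  So every reduct is in fact quadratic.
module Submission where

open import Defs
open import Data.Nat using (ℕ; _≤_)
open import Data.Product using (_×_; _,_)
open import Data.Sum using (_⊎_)
open import Data.List.Membership.Propositional using (_∈_)
open import Relation.Binary.PropositionalEquality using (_≡_)

open import Data.Nat using (suc; _+_; _*_; _≡ᵇ_; z≤n)
open import Data.Nat.Properties
open import Data.Nat.Solver using (module +-*-Solver)
open import Data.Bool using (true; false)
open import Data.List using (List; []; _∷_; _++_; [_]; length)
open import Data.List.Properties using (length-++)
open import Data.List.Relation.Unary.Any using (here; there)
open import Data.Product using (map₁)
open import Data.Sum using (inj₂)
open import Data.Empty using (⊥-elim)
open import Relation.Binary.PropositionalEquality using (refl; sym; trans; cong; cong₂; subst; subst₂; _≢_; module ≡-Reasoning)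
open import Relation.Nullary using (yes; no)
open +-*-Solver using (solve; _:+_; _:*_; _:=_; con)
open import Algebra.Properties.CommutativeSemigroup +-commutativeSemigroup using (interchange)

+-*-interchange : ∀ a b c d e → a + b * c + (d + e * c) ≡ a + d + (b + e) * c
+-*-interchange = solve 5 (λ a b c d e → a :+ b :* c :+ (d :+ e :* c) := a :+ d :+ (b :+ e) :* c) refl

module _ {k : ℕ} where

  occˢ : ℕ → Sym k → ℕ
  occˢ y u = occT y [ u ]

  occˢ-var-self : ∀ x → occˢ x (var x) ≡ 1
  occˢ-var-self x with x ≡ᵇ x | ≡⇒≡ᵇ x x refl
  ... | true | _ = refl

  occˢ-var-≢ : ∀ {z x} → z ≢ x → occˢ x (var z) ≡ 0
  occˢ-var-≢ {z} {x} z≢x with z ≡ᵇ x | ≡ᵇ⇒≡ z x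
  ... | true | z≡x = ⊥-elim (z≢x (z≡x _))
  ... | false | _ = refl

  substSym-var-self : ∀ x (t : Term k) → substSym (x , t) (var x) ≡ t
  substSym-var-self x t with x ≡ᵇ x | ≡⇒≡ᵇ x x refl
  ... | true | _ = refl

  substSym-≢ : ∀ x (t : Term k) u → u ≢ var x → substSym (x , t) u ≡ [ u ]
  substSym-≢ x t (lit a) _ = refl
  substSym-≢ x t (var z) u≢x with z ≡ᵇ x | ≡ᵇ⇒≡ z x
  ... | true | z≡x = ⊥-elim (u≢x (cong var (z≡x _)))
  ... | false | _ = refl

  occT-∷ : ∀ y (u : Sym k) s → occT y (u ∷ s) ≡ occˢ y u + occT y s
  occT-∷ y (lit _) s = refl
  occT-∷ y (var z) s = cong (_+ occT y s) (sym (+-identityʳ _))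

  occT-++ : ∀ y (a b : Term k) → occT y (a ++ b) ≡ occT y a + occT y b
  occT-++ y [] b = refl
  occT-++ y (u ∷ a) b = begin
    occT y (u ∷ a ++ b)               ≡⟨ occT-∷ y u (a ++ b) ⟩
    occˢ y u + occT y (a ++ b)    ≡⟨ cong (occˢ y u +_) (occT-++ y a b) ⟩
    occˢ y u + (occT y a + occT y b) ≡⟨ sym (+-assoc (occˢ y u) _ _) ⟩
    occˢ y u + occT y a + occT y b ≡⟨ cong (_+ occT y b) (sym (occT-∷ y u a)) ⟩
    occT y (u ∷ a) + occT y b         ∎
    where open ≡-Reasoning

  occT-substSym-≤ : ∀ y x (t : Term k) u → occT y (substSym (x , t) u) ≤ occˢ y u + occˢ x u * occT y t
  occT-substSym-≤ y x t (lit _) = z≤n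
  occT-substSym-≤ y x t (var z) with z ≟ x
  ... | yes refl = begin
    occT y (substSym (z , t) (var z))         ≡⟨ cong (occT y) (substSym-var-self z t) ⟩
    occT y t                                   ≤⟨ m≤n+m _ _ ⟩
    occˢ y (var z) + occT y t                ≡⟨ cong (occˢ y (var z) +_) (sym (*-identityˡ (occT y t))) ⟩
    occˢ y (var z) + 1 * occT y t            ≡⟨ cong (λ n → occˢ y (var z) + n * occT y t) (sym (occˢ-var-self z)) ⟩
    occˢ y (var z) + occˢ z (var z) * occT y t ∎
    where open ≤-Reasoning
  ... | no z≢x = begin
    occT y (substSym (x , t) (var z))         ≡⟨ cong (occT y) (substSym-≢ x t (var z) (λ { refl → z≢x refl })) ⟩
    occˢ y (var z)                           ≤⟨ m≤m+n _ _ ⟩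
    occˢ y (var z) + 0 * occT y t            ≡⟨ cong (λ n → occˢ y (var z) + n * occT y t) (sym (occˢ-var-≢ z≢x)) ⟩
    occˢ y (var z) + occˢ x (var z) * occT y t ∎
    where open ≤-Reasoning

  occT-substT-≤ : ∀ y x (t s : Term k) → occT y (substT (x , t) s) ≤ occT y s + occT x s * occT y t
  occT-substT-≤ y x t [] = z≤n
  occT-substT-≤ y x t (u ∷ s) = begin
    occT y (substSym (x , t) u ++ substT (x , t) s)
      ≡⟨ occT-++ y (substSym (x , t) u) (substT (x , t) s) ⟩
    occT y (substSym (x , t) u) + occT y (substT (x , t) s)
      ≤⟨ +-mono-≤ (occT-substSym-≤ y x t u) (occT-substT-≤ y x t s) ⟩
    occˢ y u + occˢ x u * c + (occT y s + occT x s * c)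
      ≡⟨ +-*-interchange (occˢ y u) (occˢ x u) c (occT y s) (occT x s) ⟩
    occˢ y u + occT y s + (occˢ x u + occT x s) * c
      ≡⟨ cong₂ (λ m n → m + n * c) (sym (occT-∷ y u s)) (sym (occT-∷ x u s)) ⟩
    occT y (u ∷ s) + occT x (u ∷ s) * c ∎
    where
    open ≤-Reasoning
    c = occT y t

  length-substSym : ∀ x (t : Term k) u → length (substSym (x , t) u) + occˢ x u ≡ 1 + occˢ x u * length t
  length-substSym x t (lit _) = refl
  length-substSym x t (var z) with z ≟ x
  ... | yes refl = begin
    length (substSym (z , t) (var z)) + occˢ z (var z) ≡⟨ cong₂ (λ s n → length s + n) (substSym-var-self z t) (occˢ-var-self z) ⟩
    length t + 1                                         ≡⟨ +-comm (length t) 1 ⟩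
    1 + length t                                         ≡⟨ cong (1 +_) (sym (*-identityˡ (length t))) ⟩
    1 + 1 * length t                                     ≡⟨ cong (λ n → 1 + n * length t) (sym (occˢ-var-self z)) ⟩
    1 + occˢ z (var z) * length t                      ∎
    where open ≡-Reasoning
  ... | no z≢x = begin
    length (substSym (x , t) (var z)) + occˢ x (var z) ≡⟨ cong₂ (λ s n → length s + n) (substSym-≢ x t (var z) (λ { refl → z≢x refl })) (occˢ-var-≢ z≢x) ⟩
    1                                                    ≡⟨ cong (λ n → 1 + n * length t) (sym (occˢ-var-≢ z≢x)) ⟩
    1 + occˢ x (var z) * length t                      ∎
    where open ≡-Reasoning

  length-substT : ∀ x (t s : Term k) → length (substT (x , t) s) + occT x s ≡ length s + occT x s * length t
  length-substT x t [] = refl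
  length-substT x t (u ∷ s) = begin
    length (substSym (x , t) u ++ substT (x , t) s) + occT x (u ∷ s)
      ≡⟨ cong₂ _+_ (length-++ (substSym (x , t) u)) (occT-∷ x u s) ⟩
    length (substSym (x , t) u) + length (substT (x , t) s) + (occˢ x u + occT x s)
      ≡⟨ interchange (length (substSym (x , t) u)) (length (substT (x , t) s)) (occˢ x u) (occT x s) ⟩
    (length (substSym (x , t) u) + occˢ x u) + (length (substT (x , t) s) + occT x s)
      ≡⟨ cong₂ _+_ (length-substSym x t u) (length-substT x t s) ⟩
    (1 + occˢ x u * length t) + (length s + occT x s * length t)
      ≡⟨ solve 4 (λ a b c l → (con 1 :+ a :* l) :+ (c :+ b :* l) := con 1 :+ c :+ (a :+ b) :* l) refl
           (occˢ x u) (occT x s) (length s) (length t) ⟩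
    1 + length s + (occˢ x u + occT x s) * length t
      ≡⟨ cong (λ n → 1 + length s + n * length t) (sym (occT-∷ x u s)) ⟩
    length (u ∷ s) + occT x (u ∷ s) * length t ∎
    where open ≡-Reasoning

  occ-substE-≤ : ∀ y x (t : Term k) e → occ y (substE e (x , t)) ≤ occ y e + occ x e * occT y t
  occ-substE-≤ y x t (a ≐ b) = begin
    occT y (substT (x , t) a) + occT y (substT (x , t) b)
      ≤⟨ +-mono-≤ (occT-substT-≤ y x t a) (occT-substT-≤ y x t b) ⟩
    occT y a + occT x a * occT y t + (occT y b + occT x b * occT y t)
      ≡⟨ +-*-interchange (occT y a) (occT x a) (occT y t) (occT y b) (occT x b) ⟩
    occT y a + occT y b + (occT x a + occT x b) * occT y t ∎
    where open ≤-Reasoning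

  len-substE : ∀ x (t : Term k) e → len (substE e (x , t)) + occ x e ≡ len e + occ x e * length t
  len-substE x t (a ≐ b) = begin
    length (substT (x , t) a) + length (substT (x , t) b) + (occT x a + occT x b)
      ≡⟨ interchange (length (substT (x , t) a)) (length (substT (x , t) b)) (occT x a) (occT x b) ⟩
    (length (substT (x , t) a) + occT x a) + (length (substT (x , t) b) + occT x b)
      ≡⟨ cong₂ _+_ (length-substT x t a) (length-substT x t b) ⟩
    length a + occT x a * length t + (length b + occT x b * length t)
      ≡⟨ +-*-interchange (length a) (occT x a) (length t) (length b) (occT x b) ⟩
    length a + length b + (occT x a + occT x b) * length t ∎
    where open ≡-Reasoning

  match-same-head : ∀ (u : Sym k) a b → match (u ∷ a ≐ u ∷ b) ≡ (a ≐ b)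
  match-same-head u a b with u ≟ˢ u
  ... | yes _ = refl
  ... | no u≢u = ⊥-elim (u≢u refl)

  occT-≤-∷ : ∀ y (u : Sym k) s → occT y s ≤ occT y (u ∷ s)
  occT-≤-∷ y u s = subst (occT y s ≤_) (sym (occT-∷ y u s)) (m≤n+m _ _)

  occ-match-≤ : ∀ y (e : Eqn k) → occ y (match e) ≤ occ y e
  occ-match-≤ y ([] ≐ b) = ≤-refl
  occ-match-≤ y (u ∷ a ≐ []) = ≤-refl
  occ-match-≤ y (u ∷ a ≐ v ∷ b) with u ≟ˢ v
  ... | yes refl = +-mono-≤ (occT-≤-∷ y u a) (occT-≤-∷ y u b)
  ... | no _ = ≤-refl

  len-match-≤ : ∀ (e : Eqn k) → len (match e) ≤ len e
  len-match-≤ ([] ≐ b) = ≤-refl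
  len-match-≤ (u ∷ a ≐ []) = ≤-refl
  len-match-≤ (u ∷ a ≐ v ∷ b) with u ≟ˢ v
  ... | yes refl = +-mono-≤ (n≤1+n (length a)) (n≤1+n (length b))
  ... | no _ = ≤-refl

  QuadraticWithin : ℕ → Eqn k → Set
  QuadraticWithin n e = Quadratic e × len e ≤ n

  match-within : ∀ {n} e → QuadraticWithin n e → QuadraticWithin n (match e)
  match-within e (quad , short) = (λ y → ≤-trans (occ-match-≤ y e) (quad y)) , ≤-trans (len-match-≤ e) short

  erase-within : ∀ x (e : Eqn k) → Quadratic e → QuadraticWithin (len e) (substE e (x , []))
  erase-within x e quad = quad′ , short
    where
    n+occ*0≡n : ∀ n → n + occ x e * 0 ≡ n
    n+occ*0≡n n = trans (cong (n +_) (*-zeroʳ (occ x e))) (+-identityʳ n)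

    quad′ : Quadratic (substE e (x , []))
    quad′ y = ≤-trans (occ-substE-≤ y x [] e) (subst (_≤ 2) (sym (n+occ*0≡n (occ y e))) (quad y))

    short : len (substE e (x , [])) ≤ len e
    short = begin
      len (substE e (x , []))                 ≤⟨ m≤m+n _ _ ⟩
      len (substE e (x , [])) + occ x e       ≡⟨ len-substE x [] e ⟩
      len e + occ x e * 0                     ≡⟨ n+occ*0≡n (len e) ⟩
      len e ∎
      where open ≤-Reasoning

  substE-once-within : ∀ x (u v : Sym k) e → occ x e ≤ 1 → (∀ y → occ y e + occT y (u ∷ v ∷ []) ≤ 2)
                     → QuadraticWithin (len e + 1) (substE e (x , u ∷ v ∷ []))
  substE-once-within x u v e once bounded = quad , short
    where
    t : Term k
    t = u ∷ v ∷ []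

    A : ℕ
    A = occ x e

    quad : Quadratic (substE e (x , t))
    quad y = begin
      occ y (substE e (x , t))  ≤⟨ occ-substE-≤ y x t e ⟩
      occ y e + A * occT y t    ≤⟨ +-monoʳ-≤ (occ y e) (*-monoˡ-≤ (occT y t) once) ⟩
      occ y e + 1 * occT y t    ≡⟨ cong (occ y e +_) (*-identityˡ (occT y t)) ⟩
      occ y e + occT y t        ≤⟨ bounded y ⟩
      2                         ∎
      where open ≤-Reasoning

    len-substituted : len (substE e (x , t)) ≡ len e + A
    len-substituted = +-cancelʳ-≡ _ (len (substE e (x , t))) (len e + A) (begin
      len (substE e (x , t)) + A ≡⟨ len-substE x t e ⟩
      len e + A * 2             ≡⟨ solve 2 (λ l a → l :+ a :* con 2 := l :+ a :+ a) refl (len e) A ⟩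
      len e + A + A             ∎)
      where open ≡-Reasoning

    short : len (substE e (x , t)) ≤ len e + 1
    short = subst (_≤ len e + 1) (sym len-substituted) (+-monoʳ-≤ (len e) once)

  match-split : ∀ x x' (h : Sym k) t₁ t₂ → x' ≢ x → h ≢ var x
              → match (substE (var x ∷ t₁ ≐ h ∷ t₂) (x , h ∷ var x' ∷ []))
                ≡ substE (var x' ∷ t₁ ≐ t₂) (x , h ∷ var x' ∷ [])
  match-split x x' h t₁ t₂ x'≢x h≢x = begin
    match (substSym σ (var x) ++ substT σ t₁ ≐ substSym σ h ++ substT σ t₂)
      ≡⟨ cong₂ (λ a b → match (a ++ substT σ t₁ ≐ b ++ substT σ t₂)) (substSym-var-self x t) (substSym-≢ x t h h≢x) ⟩
    match (h ∷ var x' ∷ substT σ t₁ ≐ h ∷ substT σ t₂)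
      ≡⟨ match-same-head h (var x' ∷ substT σ t₁) (substT σ t₂) ⟩
    var x' ∷ substT σ t₁ ≐ substT σ t₂
      ≡⟨ cong (λ a → a ++ substT σ t₁ ≐ substT σ t₂) (sym (substSym-≢ x t (var x') λ { refl → x'≢x refl })) ⟩
    substSym σ (var x') ++ substT σ t₁ ≐ substT σ t₂ ∎
    where
    open ≡-Reasoning
    t : Term k
    t = h ∷ var x' ∷ []

    σ : Subst k
    σ = x , t

  split-within : ∀ x x' (h : Sym k) t₁ t₂ → h ≢ var x
               → occ x' (var x ∷ t₁ ≐ h ∷ t₂) ≡ 0 → Quadratic (var x ∷ t₁ ≐ h ∷ t₂)
               → QuadraticWithin (len (var x ∷ t₁ ≐ h ∷ t₂))
                                 (match (substE (var x ∷ t₁ ≐ h ∷ t₂) (x , h ∷ var x' ∷ [])))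
  split-within x x' h t₁ t₂ h≢x fresh quad =
    subst₂ QuadraticWithin len-e₀ (sym (match-split x x' h t₁ t₂ x'≢x h≢x))
      (substE-once-within x h (var x') e₀ once bounded)
    where
    e e₀ : Eqn k
    e = var x ∷ t₁ ≐ h ∷ t₂
    e₀ = var x' ∷ t₁ ≐ t₂

    t : Term k
    t = h ∷ var x' ∷ []

    rest : ℕ → ℕ
    rest y = occT y t₁ + occˢ y h + occT y t₂

    occ-e : ∀ y → occ y e ≡ occˢ y (var x) + rest y
    occ-e y = trans (cong₂ _+_ (occT-∷ y (var x) t₁) (occT-∷ y h t₂))
      (solve 4 (λ p a b c → p :+ a :+ (b :+ c) := p :+ (a :+ b :+ c)) refl
        (occˢ y (var x)) (occT y t₁) (occˢ y h) (occT y t₂))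

    occ-e₀ : ∀ y → occ y e₀ + occT y t ≡ rest y + 2 * occˢ y (var x')
    occ-e₀ y = trans (cong₂ _+_ (cong (_+ occT y t₂) (occT-∷ y (var x') t₁)) (occT-∷ y h (var x' ∷ [])))
      (solve 4 (λ p a b c → p :+ a :+ c :+ (b :+ p) := a :+ b :+ c :+ con 2 :* p) refl
        (occˢ y (var x')) (occT y t₁) (occˢ y h) (occT y t₂))

    rest-≤ : ∀ y → rest y ≤ occ y e
    rest-≤ y = subst (rest y ≤_) (sym (occ-e y)) (m≤n+m (rest y) (occˢ y (var x)))

    occ-e-head : occ x e ≡ 1 + rest x
    occ-e-head = trans (occ-e x) (cong (_+ rest x) (occˢ-var-self x))

    x'≢x : x' ≢ x
    x'≢x refl = 1+n≢0 (trans (sym occ-e-head) fresh)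

    once : occ x e₀ ≤ 1
    once = begin
      occ x e₀                       ≤⟨ m≤m+n (occ x e₀) (occT x t) ⟩
      occ x e₀ + occT x t            ≡⟨ occ-e₀ x ⟩
      rest x + 2 * occˢ x (var x')   ≡⟨ cong (λ c → rest x + 2 * c) (occˢ-var-≢ x'≢x) ⟩
      rest x + 0                     ≡⟨ +-identityʳ (rest x) ⟩
      rest x                         ≤⟨ ≤-pred (subst (_≤ 2) occ-e-head (quad x)) ⟩
      1                              ∎
      where open ≤-Reasoning

    bounded : ∀ y → occ y e₀ + occT y t ≤ 2
    bounded y with y ≟ x'
    ... | yes refl = begin
      occ y e₀ + occT y t            ≡⟨ occ-e₀ y ⟩
      rest y + 2 * occˢ y (var y)    ≡⟨ cong₂ (λ r c → r + 2 * c) (n≤0⇒n≡0 (subst (rest y ≤_) fresh (rest-≤ y))) (occˢ-var-self y) ⟩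
      2                              ∎
      where open ≤-Reasoning
    ... | no y≢x' = begin
      occ y e₀ + occT y t            ≡⟨ occ-e₀ y ⟩
      rest y + 2 * occˢ y (var x')   ≡⟨ cong (λ c → rest y + 2 * c) (occˢ-var-≢ λ x'≡y → y≢x' (sym x'≡y)) ⟩
      rest y + 0                     ≡⟨ +-identityʳ (rest y) ⟩
      rest y                         ≤⟨ rest-≤ y ⟩
      occ y e                        ≤⟨ quad y ⟩
      2                              ∎
      where open ≤-Reasoning

    len-e₀ : len e₀ + 1 ≡ len e
    len-e₀ = trans (+-assoc (suc (length t₁)) (length t₂) 1) (cong (suc (length t₁) +_) (+-comm (length t₂) 1))

  swap : Eqn k → Eqn k
  swap (a ≐ b) = b ≐ a

  match-swap : ∀ (e : Eqn k) → match (swap e) ≡ swap (match e)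
  match-swap ([] ≐ []) = refl
  match-swap ([] ≐ v ∷ b) = refl
  match-swap (u ∷ a ≐ []) = refl
  match-swap (u ∷ a ≐ v ∷ b) with u ≟ˢ v | v ≟ˢ u
  ... | yes refl | yes _ = refl
  ... | yes refl | no u≢u = ⊥-elim (u≢u refl)
  ... | no u≢v | yes refl = ⊥-elim (u≢v refl)
  ... | no _ | no _ = refl

  occ-swap : ∀ y (e : Eqn k) → occ y (swap e) ≡ occ y e
  occ-swap y (a ≐ b) = +-comm (occT y b) (occT y a)

  Quadratic-swap : ∀ (e : Eqn k) → Quadratic e → Quadratic (swap e)
  Quadratic-swap e quad y = subst (_≤ 2) (sym (occ-swap y e)) (quad y)

  within-swap : ∀ (e e' : Eqn k) → QuadraticWithin (len e) e' → QuadraticWithin (len (swap e)) (swap e')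
  within-swap (a ≐ b) (a' ≐ b') (quad , short) =
    Quadratic-swap (a' ≐ b') quad ,
    subst₂ _≤_ (+-comm (length a') (length b')) (+-comm (length a) (length b)) short

  split-right-within : ∀ x x' (h : Sym k) t₁ t₂ → h ≢ var x
                     → occ x' (h ∷ t₂ ≐ var x ∷ t₁) ≡ 0 → Quadratic (h ∷ t₂ ≐ var x ∷ t₁)
                     → QuadraticWithin (len (h ∷ t₂ ≐ var x ∷ t₁))
                                       (match (substE (h ∷ t₂ ≐ var x ∷ t₁) (x , h ∷ var x' ∷ [])))
  split-right-within x x' h t₁ t₂ h≢x fresh quad =
    subst (QuadraticWithin _) (sym (match-swap (substE e (x , h ∷ var x' ∷ []))))
      (within-swap e (match (substE e (x , h ∷ var x' ∷ []))) (split-within x x' h t₁ t₂ h≢x (trans (occ-swap x' (swap e)) fresh) (Quadratic-swap (swap e) quad)))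
    where
    e : Eqn k
    e = var x ∷ t₁ ≐ h ∷ t₂

  reduce-within : ∀ (e : Eqn k) x₁' x₂' → occ x₁' e ≡ 0 → occ x₂' e ≡ 0 → Quadratic e
                → ∀ {e' σ} → (e' , σ) ∈ reduce e x₁' x₂' → QuadraticWithin (len e) e'
  reduce-within e@(var x ∷ t₁ ≐ lit c ∷ t₂) x₁' x₂' fresh₁ fresh₂ quad (here refl) =
    match-within (substE e (x , [])) (erase-within x e quad)
  reduce-within (var x ∷ t₁ ≐ lit c ∷ t₂) x₁' x₂' fresh₁ fresh₂ quad (there (here refl)) =
    split-within x x₁' (lit c) t₁ t₂ (λ ()) fresh₁ quad
  reduce-within e@(lit c ∷ t₂ ≐ var x ∷ t₁) x₁' x₂' fresh₁ fresh₂ quad (here refl) =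
    match-within (substE e (x , [])) (erase-within x e quad)
  reduce-within (lit c ∷ t₂ ≐ var x ∷ t₁) x₁' x₂' fresh₁ fresh₂ quad (there (here refl)) =
    split-right-within x x₂' (lit c) t₁ t₂ (λ ()) fresh₂ quad
  reduce-within e@(var x₁ ∷ t₁ ≐ var x₂ ∷ t₂) x₁' x₂' fresh₁ fresh₂ quad mem with x₁ ≟ x₂
  ... | no x₁≢x₂ with mem
  ...   | here refl = match-within (substE e (x₁ , [])) (erase-within x₁ e quad)
  ...   | there (here refl) = split-within x₁ x₁' (var x₂) t₁ t₂ (λ { refl → x₁≢x₂ refl }) fresh₁ quad
  ...   | there (there (here refl)) = match-within (substE e (x₂ , [])) (erase-within x₂ e quad)
  ...   | there (there (there (here refl))) =
          split-right-within x₂ x₂' (var x₁) t₂ t₁ (λ { refl → x₁≢x₂ refl }) fresh₂ quad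

mainTheorem7 : ∀ {k : ℕ} (e : Eqn k) (x₁' x₂' : ℕ)
    → occ x₁' e ≡ 0 → occ x₂' e ≡ 0
    → Quadratic e
    → ∀ (e' : Eqn k) (σ : Subst k) → (e' , σ) ∈ reduce e x₁' x₂'
    → (Unsatisfiable e' ⊎ Quadratic e') × len e' ≤ len e
mainTheorem7 e x₁' x₂' fresh₁ fresh₂ quad e' σ mem = map₁ inj₂ (reduce-within e x₁' x₂' fresh₁ fresh₂ quad mem)
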